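{- For every bunched context $\Delta(-)$ and formulas $\varphi,\psi,\chi$: (i) if $\Delta(\varphi\wedge\psi)\vdash_{\mathsf{cf}}\chi$ then $\Delta(\varphi;\psi)\vdash_{\mathsf{cf}}\chi$; (ii) if $\Delta(\varphi*\psi)\vdash_{\mathsf{cf}}\chi$ then $\Delta(\varphi,\psi)\vdash_{\mathsf{cf}}\chi$; (iii) if $\Delta(\top)\vdash_{\mathsf{cf}}\chi$ then $\Delta(\varnothing_a)\vdash_{\mathsf{cf}}\chi$; (iv) if $\Delta(\mathsf{emp})\vdash_{\mathsf{cf}}\chi$ then $\Delta(\varnothing_m)\vdash_{\mathsf{cf}}\chi$.
   Context: Formulas of BI: $\varphi,\psi ::= \top \mid \bot \mid \varphi\wedge\psi \mid \varphi\vee\psi \mid \varphi\to\psi \mid \mathsf{emp} \mid \varphi * \psi \mid \varphi \mathrel{ -\!\!*} \psi \mid a$ ($a\in\mathrm{Atom}$). Bunches: $\Delta ::= \varphi \mid \varnothing_m \mid \varnothing_a \mid \Delta , \Delta \mid \Delta ; \Delta$. A bunched context $\Delta(-)$ is a bunch with one hole; $\Delta(\Gamma)$ fills it. Bunch equivalence $\equiv$: least equivalence relation, closed under bunched contexts, making "$,$" commutative and associative with unit $\varnothing_m$ and "$;$" commutative and associative with unit $\varnothing_a$. The BI sequent calculus: (ax) $a\vdash a$ for atoms $a$; (equiv) from $\Delta'\vdash\varphi$, $\Delta\equiv\Delta'$ infer $\Delta\vdash\varphi$; (W;) from $\Delta(\Delta_1)\vdash\varphi$ infer $\Delta(\Delta_1;\Delta_2)\vdash\varphi$;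 (C;) from $\Delta(\Delta_1;\Delta_1)\vdash\varphi$ infer $\Delta(\Delta_1)\vdash\varphi$; (cut) from $\Delta'\vdash A$, $\Delta(A)\vdash B$ infer $\Delta(\Delta')\vdash B$; (empR) $\varnothing_m\vdash\mathsf{emp}$; (empL) from $\Delta(\varnothing_m)\vdash\varphi$ infer $\Delta(\mathsf{emp})\vdash\varphi$; (*R) from $\Delta_1\vdash\varphi$, $\Delta_2\vdash\psi$ infer $\Delta_1,\Delta_2\vdash\varphi*\psi$; (*L) from $\Delta(\varphi,\psi)\vdash\chi$ infer $\Delta(\varphi*\psi)\vdash\chi$; ($-\!*$R) from $\Delta,\varphi\vdash\psi$ infer $\Delta\vdash\varphi\mathrel{ -\!\!*}\psi$; ($-\!*$L) from $\Delta_1\vdash\varphi$, $\Delta(\Delta_2,\psi)\vdash\chi$ infer $\Delta((\Delta_1,\Delta_2),\varphi\mathrel{ -\!\!*}\psi)\vdash\chi$; ($\top$R) $\varnothing_a\vdash\top$; ($\top$L) from $\Delta(\varnothing_a)\vdash\varphi$ infer $\Delta(\top)\vdash\varphi$; ($\wedge$R) from $\Delta_1\vdash\varphi$, $\Delta_2\vdash\psi$ infer $\Delta_1;\Delta_2\vdash\varphi\wedge\psi$; ($\wedge$L) from $\Delta(\varphi;\psi)\vdash\chi$ infer $\Delta(\varphi\wedge\psi)\vdash\chi$; ($\to$R) from $\Delta;\varphi\vdash\psi$ infer $\Delta\vdash\varphi\to\psi$; ($\to$L) from $\Delta_1\vdash\varphi$, $\Delta(\Delta_2;\psi)\vdash\chi$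 infer $\Delta((\Delta_1;\Delta_2);\varphi\to\psi)\vdash\chi$; ($\bot$L) $\Delta(\bot)\vdash\varphi$; ($\vee$R1/2) from $\Delta\vdash\varphi$ (resp. $\Delta\vdash\psi$) infer $\Delta\vdash\varphi\vee\psi$; ($\vee$L) from $\Delta(\varphi)\vdash\chi$, $\Delta(\psi)\vdash\chi$ infer $\Delta(\varphi\vee\psi)\vdash\chi$. $\Delta\vdash_{\mathsf{cf}}\varphi$ means derivable without (cut). -}

module Defs where

data Formula (Atom : Set) : Set where
  ⊤ᶠ ⊥ᶠ emp : Formula Atom
  _∧ᶠ_ _∨ᶠ_ _⇒_ _✱_ _−✱_ : Formula Atom → Formula Atom → Formula Atom
  atom : Atom → Formula Atom

data Bunch (Atom : Set) : Set where
  fm  : Formula Atom → Bunch Atom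
  ∅m ∅a : Bunch Atom
  _,ᵇ_ _⨾ᵇ_ : Bunch Atom → Bunch Atom → Bunch Atom

data Ctx (Atom : Set) : Set where
  hole : Ctx Atom
  _,ˡ_ _⨾ˡ_ : Ctx Atom → Bunch Atom → Ctx Atom
  _,ʳ_ _⨾ʳ_ : Bunch Atom → Ctx Atom → Ctx Atom

_[_] : {Atom : Set} → Ctx Atom → Bunch Atom → Bunch Atom
hole      [ Γ ] = Γ
(C ,ˡ Δ)  [ Γ ] = (C [ Γ ]) ,ᵇ Δ
(C ⨾ˡ Δ)  [ Γ ] = (C [ Γ ]) ⨾ᵇ Δ
(Δ ,ʳ C)  [ Γ ] = Δ ,ᵇ (C [ Γ ])
(Δ ⨾ʳ C)  [ Γ ] = Δ ⨾ᵇ (C [ Γ ])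

data _≡ᵇ_ {Atom : Set} : Bunch Atom → Bunch Atom → Set where
  refl≡  : ∀ {Δ} → Δ ≡ᵇ Δ
  sym≡   : ∀ {Δ Γ} → Δ ≡ᵇ Γ → Γ ≡ᵇ Δ
  trans≡ : ∀ {Δ Γ Θ} → Δ ≡ᵇ Γ → Γ ≡ᵇ Θ → Δ ≡ᵇ Θ
  ctx≡   : ∀ (C : Ctx Atom) {Δ Γ} → Δ ≡ᵇ Γ → (C [ Δ ]) ≡ᵇ (C [ Γ ])
  ,-comm  : ∀ {Δ Γ} → (Δ ,ᵇ Γ) ≡ᵇ (Γ ,ᵇ Δ)
  ,-assoc : ∀ {Δ Γ Θ} → ((Δ ,ᵇ Γ) ,ᵇ Θ) ≡ᵇ (Δ ,ᵇ (Γ ,ᵇ Θ))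
  ,-unit  : ∀ {Δ} → (Δ ,ᵇ ∅m) ≡ᵇ Δ
  ⨾-comm  : ∀ {Δ Γ} → (Δ ⨾ᵇ Γ) ≡ᵇ (Γ ⨾ᵇ Δ)
  ⨾-assoc : ∀ {Δ Γ Θ} → ((Δ ⨾ᵇ Γ) ⨾ᵇ Θ) ≡ᵇ (Δ ⨾ᵇ (Γ ⨾ᵇ Θ))
  ⨾-unit  : ∀ {Δ} → (Δ ⨾ᵇ ∅a) ≡ᵇ Δ

data _⊢cf_ {Atom : Set} : Bunch Atom → Formula Atom → Set where
  ax    : ∀ a → fm (atom a) ⊢cf atom a
  equiv : ∀ {Δ Δ' φ} → Δ' ⊢cf φ → Δ ≡ᵇ Δ' → Δ ⊢cf φ
  W⨾    : ∀ (C : Ctx Atom) {Δ₁ Δ₂ φ} → (C [ Δ₁ ]) ⊢cf φ → (C [ Δ₁ ⨾ᵇ Δ₂ ]) ⊢cf φ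
  C⨾    : ∀ (C : Ctx Atom) {Δ₁ φ} → (C [ Δ₁ ⨾ᵇ Δ₁ ]) ⊢cf φ → (C [ Δ₁ ]) ⊢cf φ
  empR  : ∅m ⊢cf emp
  empL  : ∀ (C : Ctx Atom) {φ} → (C [ ∅m ]) ⊢cf φ → (C [ fm emp ]) ⊢cf φ
  ✱R    : ∀ {Δ₁ Δ₂ φ ψ} → Δ₁ ⊢cf φ → Δ₂ ⊢cf ψ → (Δ₁ ,ᵇ Δ₂) ⊢cf (φ ✱ ψ)
  ✱L    : ∀ (C : Ctx Atom) {φ ψ χ} → (C [ fm φ ,ᵇ fm ψ ]) ⊢cf χ → (C [ fm (φ ✱ ψ) ]) ⊢cf χ
  −✱R   : ∀ {Δ φ ψ} → (Δ ,ᵇ fm φ) ⊢cf ψ → Δ ⊢cf (φ −✱ ψ)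
  −✱L   : ∀ (C : Ctx Atom) {Δ₁ Δ₂ φ ψ χ} → Δ₁ ⊢cf φ → (C [ Δ₂ ,ᵇ fm ψ ]) ⊢cf χ
          → (C [ (Δ₁ ,ᵇ Δ₂) ,ᵇ fm (φ −✱ ψ) ]) ⊢cf χ
  ⊤R    : ∅a ⊢cf ⊤ᶠ
  ⊤L    : ∀ (C : Ctx Atom) {φ} → (C [ ∅a ]) ⊢cf φ → (C [ fm ⊤ᶠ ]) ⊢cf φ
  ∧R    : ∀ {Δ₁ Δ₂ φ ψ} → Δ₁ ⊢cf φ → Δ₂ ⊢cf ψ → (Δ₁ ⨾ᵇ Δ₂) ⊢cf (φ ∧ᶠ ψ)
  ∧L    : ∀ (C : Ctx Atom) {φ ψ χ} → (C [ fm φ ⨾ᵇ fm ψ ]) ⊢cf χ → (C [ fm (φ ∧ᶠ ψ) ]) ⊢cf χ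
  ⇒R    : ∀ {Δ φ ψ} → (Δ ⨾ᵇ fm φ) ⊢cf ψ → Δ ⊢cf (φ ⇒ ψ)
  ⇒L    : ∀ (C : Ctx Atom) {Δ₁ Δ₂ φ ψ χ} → Δ₁ ⊢cf φ → (C [ Δ₂ ⨾ᵇ fm ψ ]) ⊢cf χ
          → (C [ (Δ₁ ⨾ᵇ Δ₂) ⨾ᵇ fm (φ ⇒ ψ) ]) ⊢cf χ
  ⊥L    : ∀ (C : Ctx Atom) {φ} → (C [ fm ⊥ᶠ ]) ⊢cf φ
  ∨R₁   : ∀ {Δ φ ψ} → Δ ⊢cf φ → Δ ⊢cf (φ ∨ᶠ ψ)
  ∨R₂   : ∀ {Δ φ ψ} → Δ ⊢cf ψ → Δ ⊢cf (φ ∨ᶠ ψ)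
  ∨L    : ∀ (C : Ctx Atom) {φ ψ χ} → (C [ fm φ ]) ⊢cf χ → (C [ fm ψ ]) ⊢cf χ
          → (C [ fm (φ ∨ᶠ ψ) ]) ⊢cf χ

-- The four rewritings are proved simultaneously: Δ ↝ Γ says that Γ arises from
-- Δ by replacing any number of occurrences of ⊤, emp, φ ∧ ψ, φ ✱ ψ by ∅a, ∅m,
-- φ ; ψ, φ , ψ respectively. Arbitrary sets of occurrences are needed because
-- contraction duplicates the formula being inverted. A cut-free derivation of
-- Δ ⊢ χ is transformed rule by rule into one of Γ ⊢ χ: every rule commutes
-- with ↝, and a left rule whose principal formula has been unfolded is
-- dropped, its premise being exactly what is needed. Bunch equivalence is
-- handled by showing that ↝ is a bisimulation up to ≡ᵇ.
module Submission where

open import Defs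
open import Data.Product using (Σ-syntax; _×_; _,_)
open import Relation.Binary.PropositionalEquality using (_≡_; refl)

module _ {Atom : Set} where

  data _↝_ : Bunch Atom → Bunch Atom → Set where
    fm     : ∀ φ → fm φ ↝ fm φ
    ∅m     : ∅m ↝ ∅m
    ∅a     : ∅a ↝ ∅a
    _,ᵇ_   : ∀ {Δ₁ Γ₁ Δ₂ Γ₂} → Δ₁ ↝ Γ₁ → Δ₂ ↝ Γ₂ → (Δ₁ ,ᵇ Δ₂) ↝ (Γ₁ ,ᵇ Γ₂)
    _⨾ᵇ_   : ∀ {Δ₁ Γ₁ Δ₂ Γ₂} → Δ₁ ↝ Γ₁ → Δ₂ ↝ Γ₂ → (Δ₁ ⨾ᵇ Δ₂) ↝ (Γ₁ ⨾ᵇ Γ₂)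
    ⊤↝∅a   : fm ⊤ᶠ ↝ ∅a
    emp↝∅m : fm emp ↝ ∅m
    ∧↝⨾    : ∀ {φ ψ} → fm (φ ∧ᶠ ψ) ↝ (fm φ ⨾ᵇ fm ψ)
    ✱↝,    : ∀ {φ ψ} → fm (φ ✱ ψ) ↝ (fm φ ,ᵇ fm ψ)

  data _↝ᶜ_ : Ctx Atom → Ctx Atom → Set where
    hole : hole ↝ᶜ hole
    _,ˡ_ : ∀ {C C' Δ Γ} → C ↝ᶜ C' → Δ ↝ Γ → (C ,ˡ Δ) ↝ᶜ (C' ,ˡ Γ)
    _⨾ˡ_ : ∀ {C C' Δ Γ} → C ↝ᶜ C' → Δ ↝ Γ → (C ⨾ˡ Δ) ↝ᶜ (C' ⨾ˡ Γ)
    _,ʳ_ : ∀ {C C' Δ Γ} → Δ ↝ Γ → C ↝ᶜ C' → (Δ ,ʳ C) ↝ᶜ (Γ ,ʳ C')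
    _⨾ʳ_ : ∀ {C C' Δ Γ} → Δ ↝ Γ → C ↝ᶜ C' → (Δ ⨾ʳ C) ↝ᶜ (Γ ⨾ʳ C')

  ↝-refl : ∀ Δ → Δ ↝ Δ
  ↝-refl (fm φ)    = fm φ
  ↝-refl ∅m        = ∅m
  ↝-refl ∅a        = ∅a
  ↝-refl (Δ ,ᵇ Γ)  = ↝-refl Δ ,ᵇ ↝-refl Γ
  ↝-refl (Δ ⨾ᵇ Γ)  = ↝-refl Δ ⨾ᵇ ↝-refl Γ

  ↝ᶜ-refl : ∀ C → C ↝ᶜ C
  ↝ᶜ-refl hole     = hole
  ↝ᶜ-refl (C ,ˡ Δ) = ↝ᶜ-refl C ,ˡ ↝-refl Δ
  ↝ᶜ-refl (C ⨾ˡ Δ) = ↝ᶜ-refl C ⨾ˡ ↝-refl Δ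
  ↝ᶜ-refl (Δ ,ʳ C) = ↝-refl Δ ,ʳ ↝ᶜ-refl C
  ↝ᶜ-refl (Δ ⨾ʳ C) = ↝-refl Δ ⨾ʳ ↝ᶜ-refl C

  ↝-fill : ∀ {C C' Δ Γ} → C ↝ᶜ C' → Δ ↝ Γ → (C [ Δ ]) ↝ (C' [ Γ ])
  ↝-fill hole       u = u
  ↝-fill (c ,ˡ v)   u = ↝-fill c u ,ᵇ v
  ↝-fill (c ⨾ˡ v)   u = ↝-fill c u ⨾ᵇ v
  ↝-fill (v ,ʳ c)   u = v ,ᵇ ↝-fill c u
  ↝-fill (v ⨾ʳ c)   u = v ⨾ᵇ ↝-fill c u

  record Split (C : Ctx Atom) (Δ Γ : Bunch Atom) : Set where
    constructor split
    field
      {C'}   : Ctx Atom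
      {Γ₀}   : Bunch Atom
      Γ≡     : Γ ≡ C' [ Γ₀ ]
      ctx↝   : C ↝ᶜ C'
      plug↝  : Δ ↝ Γ₀

  ↝-split : ∀ C {Δ Γ} → (C [ Δ ]) ↝ Γ → Split C Δ Γ
  ↝-split hole u = split refl hole u
  ↝-split (C ,ˡ _) (u ,ᵇ v) with ↝-split C u
  ... | split refl c w = split refl (c ,ˡ v) w
  ↝-split (C ⨾ˡ _) (u ⨾ᵇ v) with ↝-split C u
  ... | split refl c w = split refl (c ⨾ˡ v) w
  ↝-split (_ ,ʳ C) (v ,ᵇ u) with ↝-split C u
  ... | split refl c w = split refl (v ,ʳ c) w
  ↝-split (_ ⨾ʳ C) (v ⨾ᵇ u) with ↝-split C u
  ... | split refl c w = split refl (v ⨾ʳ c) w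

  Simulates : Bunch Atom → Bunch Atom → Set
  Simulates Δ Δ' = ∀ {Γ} → Δ ↝ Γ → Σ[ Γ' ∈ Bunch Atom ] Δ' ↝ Γ' × Γ ≡ᵇ Γ'

  Bisimilar : Bunch Atom → Bunch Atom → Set
  Bisimilar Δ Δ' = Simulates Δ Δ' × Simulates Δ' Δ

  bisimilar-sym : ∀ {Δ Δ'} → Bisimilar Δ Δ' → Bisimilar Δ' Δ
  bisimilar-sym (f , b) = b , f

  simulates-trans : ∀ {Δ Δ' Δ''} → Simulates Δ Δ' → Simulates Δ' Δ'' → Simulates Δ Δ''
  simulates-trans f g u with f u
  ... | _ , u' , e with g u'
  ...   | _ , u'' , e' = _ , u'' , trans≡ e e'

  simulates-ctx : ∀ C {Δ Δ'} → Simulates Δ Δ' → Simulates (C [ Δ ]) (C [ Δ' ])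
  simulates-ctx C f u with ↝-split C u
  ... | split {C'} refl c w with f w
  ...   | _ , w' , e = _ , ↝-fill c w' , ctx≡ C' e

  ≡ᵇ⇒bisimilar : ∀ {Δ Δ'} → Δ ≡ᵇ Δ' → Bisimilar Δ Δ'
  ≡ᵇ⇒bisimilar refl≡ = (λ u → _ , u , refl≡) , (λ u → _ , u , refl≡)
  ≡ᵇ⇒bisimilar (sym≡ e) = bisimilar-sym (≡ᵇ⇒bisimilar e)
  ≡ᵇ⇒bisimilar (trans≡ e₁ e₂) with ≡ᵇ⇒bisimilar e₁ | ≡ᵇ⇒bisimilar e₂
  ... | f₁ , b₁ | f₂ , b₂ = simulates-trans f₁ f₂ , simulates-trans b₂ b₁
  ≡ᵇ⇒bisimilar (ctx≡ C e) with ≡ᵇ⇒bisimilar e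
  ... | f , b = simulates-ctx C f , simulates-ctx C b
  ≡ᵇ⇒bisimilar ,-comm =
      (λ { (u ,ᵇ v) → _ , v ,ᵇ u , ,-comm })
    , (λ { (u ,ᵇ v) → _ , v ,ᵇ u , ,-comm })
  ≡ᵇ⇒bisimilar ,-assoc =
      (λ { ((u ,ᵇ v) ,ᵇ w) → _ , u ,ᵇ (v ,ᵇ w) , ,-assoc })
    , (λ { (u ,ᵇ (v ,ᵇ w)) → _ , (u ,ᵇ v) ,ᵇ w , sym≡ ,-assoc })
  ≡ᵇ⇒bisimilar ,-unit =
      (λ { (u ,ᵇ ∅m) → _ , u , ,-unit })
    , (λ u → _ , u ,ᵇ ∅m , sym≡ ,-unit)
  ≡ᵇ⇒bisimilar ⨾-comm =
      (λ { (u ⨾ᵇ v) → _ , v ⨾ᵇ u , ⨾-comm })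
    , (λ { (u ⨾ᵇ v) → _ , v ⨾ᵇ u , ⨾-comm })
  ≡ᵇ⇒bisimilar ⨾-assoc =
      (λ { ((u ⨾ᵇ v) ⨾ᵇ w) → _ , u ⨾ᵇ (v ⨾ᵇ w) , ⨾-assoc })
    , (λ { (u ⨾ᵇ (v ⨾ᵇ w)) → _ , (u ⨾ᵇ v) ⨾ᵇ w , sym≡ ⨾-assoc })
  ≡ᵇ⇒bisimilar ⨾-unit =
      (λ { (u ⨾ᵇ ∅a) → _ , u , ⨾-unit })
    , (λ u → _ , u ⨾ᵇ ∅a , sym≡ ⨾-unit)

  ⊢cf-↝ : ∀ {Δ Γ χ} → Δ ⊢cf χ → Δ ↝ Γ → Γ ⊢cf χ
  ⊢cf-↝ (ax a) (fm _) = ax a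
  ⊢cf-↝ (equiv d e) u with ≡ᵇ⇒bisimilar e
  ... | f , _ with f u
  ...   | _ , u' , e' = equiv (⊢cf-↝ d u') e'
  ⊢cf-↝ (W⨾ C d) u with ↝-split C u
  ... | split {C'} refl c (v ⨾ᵇ _) = W⨾ C' (⊢cf-↝ d (↝-fill c v))
  ⊢cf-↝ (C⨾ C d) u with ↝-split C u
  ... | split {C'} refl c v = C⨾ C' (⊢cf-↝ d (↝-fill c (v ⨾ᵇ v)))
  ⊢cf-↝ empR ∅m = empR
  ⊢cf-↝ (empL C d) u with ↝-split C u
  ... | split {C'} refl c (fm _) = empL C' (⊢cf-↝ d (↝-fill c ∅m))
  ... | split refl c emp↝∅m      = ⊢cf-↝ d (↝-fill c ∅m)
  ⊢cf-↝ (✱R d₁ d₂) (u ,ᵇ v) = ✱R (⊢cf-↝ d₁ u) (⊢cf-↝ d₂ v)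
  ⊢cf-↝ (✱L C d) u with ↝-split C u
  ... | split {C'} refl c (fm _) = ✱L C' (⊢cf-↝ d (↝-fill c (fm _ ,ᵇ fm _)))
  ... | split refl c ✱↝,         = ⊢cf-↝ d (↝-fill c (fm _ ,ᵇ fm _))
  ⊢cf-↝ (−✱R d) u = −✱R (⊢cf-↝ d (u ,ᵇ fm _))
  ⊢cf-↝ (−✱L C d₁ d₂) u with ↝-split C u
  ... | split {C'} refl c ((v₁ ,ᵇ v₂) ,ᵇ fm _) =
    −✱L C' (⊢cf-↝ d₁ v₁) (⊢cf-↝ d₂ (↝-fill c (v₂ ,ᵇ fm _)))
  ⊢cf-↝ ⊤R ∅a = ⊤R
  ⊢cf-↝ (⊤L C d) u with ↝-split C u
  ... | split {C'} refl c (fm _) = ⊤L C' (⊢cf-↝ d (↝-fill c ∅a))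
  ... | split refl c ⊤↝∅a        = ⊢cf-↝ d (↝-fill c ∅a)
  ⊢cf-↝ (∧R d₁ d₂) (u ⨾ᵇ v) = ∧R (⊢cf-↝ d₁ u) (⊢cf-↝ d₂ v)
  ⊢cf-↝ (∧L C d) u with ↝-split C u
  ... | split {C'} refl c (fm _) = ∧L C' (⊢cf-↝ d (↝-fill c (fm _ ⨾ᵇ fm _)))
  ... | split refl c ∧↝⨾         = ⊢cf-↝ d (↝-fill c (fm _ ⨾ᵇ fm _))
  ⊢cf-↝ (⇒R d) u = ⇒R (⊢cf-↝ d (u ⨾ᵇ fm _))
  ⊢cf-↝ (⇒L C d₁ d₂) u with ↝-split C u
  ... | split {C'} refl c ((v₁ ⨾ᵇ v₂) ⨾ᵇ fm _) =
    ⇒L C' (⊢cf-↝ d₁ v₁) (⊢cf-↝ d₂ (↝-fill c (v₂ ⨾ᵇ fm _)))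
  ⊢cf-↝ (⊥L C) u with ↝-split C u
  ... | split {C'} refl _ (fm _) = ⊥L C'
  ⊢cf-↝ (∨R₁ d) u = ∨R₁ (⊢cf-↝ d u)
  ⊢cf-↝ (∨R₂ d) u = ∨R₂ (⊢cf-↝ d u)
  ⊢cf-↝ (∨L C d₁ d₂) u with ↝-split C u
  ... | split {C'} refl c (fm _) =
    ∨L C' (⊢cf-↝ d₁ (↝-fill c (fm _))) (⊢cf-↝ d₂ (↝-fill c (fm _)))

  ⊢cf-unfold : ∀ C {Δ Γ χ} → Δ ↝ Γ → (C [ Δ ]) ⊢cf χ → (C [ Γ ]) ⊢cf χ
  ⊢cf-unfold C u d = ⊢cf-↝ d (↝-fill (↝ᶜ-refl C) u)

lemma3p4 : {Atom : Set} (C : Ctx Atom) (φ ψ χ : Formula Atom)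
    → ((C [ fm (φ ∧ᶠ ψ) ]) ⊢cf χ → (C [ fm φ ⨾ᵇ fm ψ ]) ⊢cf χ)
    × ((C [ fm (φ ✱ ψ) ]) ⊢cf χ → (C [ fm φ ,ᵇ fm ψ ]) ⊢cf χ)
    × ((C [ fm ⊤ᶠ ]) ⊢cf χ → (C [ ∅a ]) ⊢cf χ)
    × ((C [ fm emp ]) ⊢cf χ → (C [ ∅m ]) ⊢cf χ)
lemma3p4 C φ ψ χ =
    ⊢cf-unfold C ∧↝⨾
  , ⊢cf-unfold C ✱↝,
  , ⊢cf-unfold C ⊤↝∅a
  , ⊢cf-unfold C emp↝∅m
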